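{- Let $a,b,r$ be integers with $2\le a,b\le r$. For a graph $G$ let $N(K_{a,b},G)$ denote the number of subgraphs of $G$ isomorphic to $K_{a,b}$. Then among all (finite, nonempty) graphs $G$ with maximum degree at most $r$, the ratio $N(K_{a,b},G)/|V(G)|$ is maximized by $G=K_{r,r}$; moreover $K_{r,r}$ is the unique connected graph with maximum degree at most $r$ attaining this maximum.
   Context: Graphs are finite and simple; a graph has maximum degree at most $r$ iff it contains no $K_{1,r+1}$ as a subgraph. The paper phrases this as: $\mathrm{ex}(n,K_{a,b},K_{1,r+1})/n$ is maximized by $K_{r,r}$, where $\mathrm{ex}(n,T,F)$ is the maximum number of copies of $T$ in an $F$-free graph on $n$ vertices. -}

module Defs where

open import Data.Nat using (ℕ; zero; suc; _+_; _*_; _≤_; _<ᵇ_; _≡ᵇ_; _/_)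
open import Data.Bool using (Bool; true; false; _∧_; _xor_; not; if_then_else_; T)
open import Data.Fin using (Fin; toℕ)
open import Data.Fin.Subset using (Subset; ∣_∣)
open import Data.Vec using (Vec; []; _∷_; lookup)
open import Data.List using (List; []; _∷_; _++_; map; concatMap; allFin; [_])
open import Data.Nat.ListAction using (sum)
open import Data.Bool.ListAction using (all)
open import Data.Product using (_×_; _,_)
open import Function.Bundles using (_↔_; Inverse)
open import Relation.Binary.PropositionalEquality using (_≡_)

record Graph (n : ℕ) : Set where
  field
    adj   : Fin n → Fin n → Bool
    sym   : ∀ i j → adj i j ≡ adj j i
    irrefl : ∀ i → adj i i ≡ false
open Graph public

deg : ∀ {n} → Graph n → Fin n → ℕ
deg {n} G v = sum (map (λ w → if adj G v w then 1 else 0) (allFin n))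

MaxDegAtMost : ∀ {n} → ℕ → Graph n → Set
MaxDegAtMost r G = ∀ v → deg G v ≤ r

data Reachable {n : ℕ} (G : Graph n) : Fin n → Fin n → Set where
  here : ∀ {u} → Reachable G u u
  step : ∀ {u v w} → T (adj G u v) → Reachable G v w → Reachable G u w

Connected : ∀ {n} → Graph n → Set
Connected {n} G = ∀ (u v : Fin n) → Reachable G u v

record _≅_ {n m : ℕ} (G : Graph n) (H : Graph m) : Set where
  field
    bij      : Fin n ↔ Fin m
    preserve : ∀ i j → adj G i j ≡ adj H (Inverse.to bij i) (Inverse.to bij j)

-- complete bipartite graph K_{r,s} on Fin (r + s): first r vertices vs last s
K : (r s : ℕ) → Graph (r + s)
K r s = record { adj = λ i j → (toℕ i <ᵇ r) xor (toℕ j <ᵇ r)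
               ; sym = symK ; irrefl = irrK }
  where
  open import Relation.Binary.PropositionalEquality using (refl)
  symK : ∀ (i j : Fin (r + s)) → ((toℕ i <ᵇ r) xor (toℕ j <ᵇ r)) ≡ ((toℕ j <ᵇ r) xor (toℕ i <ᵇ r))
  symK i j with toℕ i <ᵇ r | toℕ j <ᵇ r
  ... | true  | true  = refl
  ... | true  | false = refl
  ... | false | true  = refl
  ... | false | false = refl
  irrK : ∀ (i : Fin (r + s)) → ((toℕ i <ᵇ r) xor (toℕ i <ᵇ r)) ≡ false
  irrK i with toℕ i <ᵇ r
  ... | true  = refl
  ... | false = refl

allSubsets : (n : ℕ) → List (Subset n)
allSubsets zero    = [ [] ]
allSubsets (suc n) = map (true ∷_) (allSubsets n) ++ map (false ∷_) (allSubsets n)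

isKab : ∀ {n} → ℕ → ℕ → Graph n → Subset n → Subset n → Bool
isKab {n} a b G A B =
  (∣ A ∣ ≡ᵇ a) ∧ (∣ B ∣ ≡ᵇ b)
  ∧ all (λ i → not (lookup A i ∧ lookup B i)) (allFin n)
  ∧ all (λ i → all (λ j → not (lookup A i ∧ lookup B j) Data.Bool.∨ adj G i j) (allFin n)) (allFin n)

orderedKab : ∀ {n} → ℕ → ℕ → Graph n → ℕ
orderedKab {n} a b G =
  sum (concatMap (λ A → map (λ B → if isKab a b G A B then 1 else 0) (allSubsets n)) (allSubsets n))

-- For a,b ≥ 1 such a subgraph is determined by its (unique) bipartition {A,B};
-- for a ≠ b the ordered pair (A,B) with |A| = a is unique, for a = b each
-- subgraph is counted twice by ordered pairs.
N : ℕ → ℕ → ∀ {n} → Graph n → ℕ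
N a b G = if a ≡ᵇ b then orderedKab a b G / 2 else orderedKab a b G

module Submission where

-- Let pairs(G) be the number of ordered pairs (A , B) spanning a K_{a,b}.  Counting the
-- incidences v ∈ A gives  a · pairs(G) = Σ_v pairsThrough(v).  For such a pair with v ∈ A,
-- B is a b-subset of N(v) and A is an a-subset through v of the common neighbourhood of B,
-- which lies inside N(u) for any u ∈ B and so has at most r elements.  Hence
-- pairsThrough(v) ≤ C(r,b)·C(r-1,a-1), and the absorption identity a·C(r,a) = r·C(r-1,a-1)
-- turns this into  r · pairs(G) ≤ C(r,a)·C(r,b) · |V(G)|.  The two sides of K_{r,r} give
-- 2·C(r,a)·C(r,b) pairs, so K_{r,r} attains the bound; dividing by the symmetry factor of N
-- gives the ratio bound.  In the equality case every local estimate is tight: G is r-regular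
-- and each b-subset B of a neighbourhood has common neighbourhood N(u) for every u ∈ B.  As
-- 2 ≤ b ≤ r, any two neighbours of a vertex then have equal neighbourhoods, and a connected
-- graph with this property is K_{r,r}.

open import Data.Nat
open import Data.Nat.Properties
open import Data.Nat.Combinatorics using (_C_; nCk+nC[k+1]≡[n+1]C[k+1]; nC1≡n)
open import Data.Nat.DivMod using (m*n/n≡m; m/n*n≤m)
open import Data.Nat.ListAction using (sum)
open import Data.Nat.ListAction.Properties using (sum-++)
open import Data.Nat.Tactic.RingSolver using (solve-∀)
open import Data.Bool using (Bool; true; false; not; _∧_; _∨_; _xor_; T; if_then_else_)
open import Data.Bool.Properties using (∧-zeroʳ; T-≡; T-∧)
open import Data.Bool.ListAction using (all)
open import Data.Empty using (⊥; ⊥-elim)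
open import Data.Product using (_×_; _,_; proj₁; proj₂; ∃)
open import Data.Sum using (_⊎_; inj₁; inj₂)
open import Data.List using (List; []; _∷_; _++_; map; length; concatMap; allFin)
import Data.List.Properties as List
open import Data.List.Membership.Propositional using () renaming (_∈_ to _∈ˡ_)
open import Data.List.Membership.Propositional.Properties using (∈-++⁺ˡ; ∈-++⁺ʳ; ∈-map⁺; ∈-allFin)
open import Data.List.Relation.Unary.Any using (here; there)
import Data.List.Relation.Unary.All as All
open import Data.List.Relation.Unary.All.Properties using (all⁺; all⁻; tabulate⁺)
open import Data.Vec using ([]; _∷_; here; there; lookup; tabulate)
open import Data.Vec.Properties using ([]=⇒lookup; lookup⇒[]=; lookup∘tabulate; tabulate-∘; tabulate-cong)
open import Data.Fin using (Fin; zero; suc; toℕ; fromℕ<; punchIn)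
open import Data.Fin.Properties using (toℕ-fromℕ<; all?)
open import Data.Fin.Permutation using (Permutation; _⟨$⟩ʳ_; lift₀; insert; insert-punchIn)
import Data.Fin.Permutation as Perm
open import Data.Fin.Subset using (Subset; inside; outside; _∈_; _∉_; _⊆_; _∪_; ∁; ⁅_⁆; ∣_∣)
open import Data.Fin.Subset.Properties
  using (_⊆?_; _∈?_; x∈p⇒∣p-x∣<∣p∣; nonempty?; Empty-unique; ∣⊥∣≡0; drop-∷-⊆; p⊆q⇒∣p∣≤∣q∣;
         ∣p∣≤n; ∣p∣≤∣x∷p∣; ∣∁p∣≡n∸∣p∣; s⊆s; out⊆; ⊆-refl; x∈⁅x⁆; x∈⁅y⁆⇒x≡y; ∣⁅x⁆∣≡1;
         p⊆p∪q; q⊆p∪q; x∈p∪q⁻)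
open import Relation.Nullary using (¬_; Dec; does; yes; no; contradiction)
open import Relation.Nullary.Decidable using (dec-true; T?; _→-dec_; isYes; toWitness; fromWitness)
open import Relation.Binary.PropositionalEquality
open import Function.Bundles using (_⇔_; mk⇔; Equivalence)
open import Defs hiding (sym)

∑ : {A : Set} → List A → (A → ℕ) → ℕ
∑ xs f = sum (map f xs)

infix 5 ∑
syntax ∑ xs (λ x → e) = ∑[ x ← xs ] e

private
  variable
    X Y : Set

∑-cong : ∀ (xs : List X) {f g : X → ℕ} → (∀ x → f x ≡ g x) → ∑ xs f ≡ ∑ xs g
∑-cong []       f≗g = refl
∑-cong (x ∷ xs) f≗g = cong₂ _+_ (f≗g x) (∑-cong xs f≗g)

∑-mono : ∀ (xs : List X) {f g : X → ℕ} → (∀ x → f x ≤ g x) → ∑ xs f ≤ ∑ xs g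
∑-mono []       f≤g = z≤n
∑-mono (x ∷ xs) f≤g = +-mono-≤ (f≤g x) (∑-mono xs f≤g)

∑-const : ∀ (xs : List X) c → ∑[ _ ← xs ] c ≡ length xs * c
∑-const []       c = refl
∑-const (x ∷ xs) c = cong (c +_) (∑-const xs c)

∑-+ : ∀ (xs : List X) (f g : X → ℕ) → ∑[ x ← xs ] (f x + g x) ≡ ∑ xs f + ∑ xs g
∑-+ []       f g = refl
∑-+ (x ∷ xs) f g = trans (cong ((f x + g x) +_) (∑-+ xs f g)) (interchange (f x) (g x) (∑ xs f) (∑ xs g))
  where
  interchange : ∀ p q s t → (p + q) + (s + t) ≡ (p + s) + (q + t)
  interchange = solve-∀

∑-zero : ∀ (xs : List X) → ∑[ _ ← xs ] 0 ≡ 0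
∑-zero xs = trans (∑-const xs 0) (*-zeroʳ (length xs))

∑-*ˡ : ∀ (xs : List X) c (f : X → ℕ) → ∑[ x ← xs ] (c * f x) ≡ c * ∑ xs f
∑-*ˡ []       c f = sym (*-zeroʳ c)
∑-*ˡ (x ∷ xs) c f = trans (cong (c * f x +_) (∑-*ˡ xs c f)) (sym (*-distribˡ-+ c (f x) _))

∑-*ʳ : ∀ (xs : List X) c (f : X → ℕ) → ∑[ x ← xs ] (f x * c) ≡ ∑ xs f * c
∑-*ʳ xs c f = trans (∑-cong xs (λ x → *-comm (f x) c)) (trans (∑-*ˡ xs c f) (*-comm c _))

∑-++ : ∀ (xs ys : List X) (f : X → ℕ) → ∑ (xs ++ ys) f ≡ ∑ xs f + ∑ ys f
∑-++ xs ys f = trans (cong sum (List.map-++ f xs ys)) (sum-++ (map f xs) (map f ys))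

∑-map : ∀ (g : Y → X) (ys : List Y) (f : X → ℕ) → ∑ (map g ys) f ≡ ∑[ y ← ys ] f (g y)
∑-map g ys f = cong sum (sym (List.map-∘ {g = f} {f = g} ys))

∑-swap : ∀ (xs : List X) (ys : List Y) (f : X → Y → ℕ) →
         ∑[ x ← xs ] ∑[ y ← ys ] f x y ≡ ∑[ y ← ys ] ∑[ x ← xs ] f x y
∑-swap []       ys f = sym (∑-zero ys)
∑-swap (x ∷ xs) ys f =
  trans (cong (∑ ys (f x) +_) (∑-swap xs ys f)) (sym (∑-+ ys (f x) (λ y → ∑[ x′ ← xs ] f x′ y)))

∑-tight : ∀ (xs : List X) {f g : X → ℕ} → (∀ x → f x ≤ g x) → ∑ xs g ≤ ∑ xs f →
          ∀ {x} → x ∈ˡ xs → f x ≡ g x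
∑-tight (y ∷ ys) {f} {g} f≤g sg≤sf x∈ = go x∈
  where
  head≥ : g y ≤ f y
  head≥ = +-cancelʳ-≤ (∑ ys g) (g y) (f y)
            (≤-trans sg≤sf (+-monoʳ-≤ (f y) (∑-mono ys f≤g)))
  tail≥ : ∑ ys g ≤ ∑ ys f
  tail≥ = +-cancelˡ-≤ (g y) (∑ ys g) (∑ ys f)
            (≤-trans sg≤sf (+-monoˡ-≤ (∑ ys f) (f≤g y)))
  go : ∀ {x} → x ∈ˡ y ∷ ys → f x ≡ g x
  go (here refl) = ≤-antisym (f≤g y) head≥
  go (there x∈)  = ∑-tight ys f≤g tail≥ x∈

∑-product : ∀ (xs : List X) (ys : List Y) (f : X → ℕ) (g : Y → ℕ) →
  ∑[ x ← xs ] ∑[ y ← ys ] (f x * g y) ≡ ∑ xs f * ∑ ys g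
∑-product xs ys f g =
  trans (∑-cong xs (λ x → ∑-*ˡ ys (f x) g)) (∑-*ʳ xs (∑ ys g) f)

sum-concatMap : ∀ (xs : List X) (ys : List Y) (f : X → Y → ℕ) →
  sum (concatMap (λ x → map (f x) ys) xs) ≡ ∑[ x ← xs ] ∑[ y ← ys ] f x y
sum-concatMap []       ys f = refl
sum-concatMap (x ∷ xs) ys f =
  trans (sum-++ (map (f x) ys) _) (cong (∑ ys (f x) +_) (sum-concatMap xs ys f))

∑-allSubsets-suc : ∀ n (f : Subset (suc n) → ℕ) →
  ∑ (allSubsets (suc n)) f ≡ (∑[ A ← allSubsets n ] f (inside ∷ A)) + (∑[ A ← allSubsets n ] f (outside ∷ A))
∑-allSubsets-suc n f = trans (∑-++ (map (inside ∷_) S) (map (outside ∷_) S) f)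
                             (cong₂ _+_ (∑-map (inside ∷_) S f) (∑-map (outside ∷_) S f))
  where S = allSubsets n

∑-allFin-const : ∀ n c → ∑[ _ ← allFin n ] c ≡ n * c
∑-allFin-const n c = trans (∑-const (allFin n) c) (cong (_* c) (List.length-tabulate {n = n} (λ i → i)))

∈-allSubsets : ∀ {n} (A : Subset n) → A ∈ˡ allSubsets n
∈-allSubsets []            = here refl
∈-allSubsets (inside ∷ A)  = ∈-++⁺ˡ (∈-map⁺ (inside ∷_) (∈-allSubsets A))
∈-allSubsets (outside ∷ A) = ∈-++⁺ʳ _ (∈-map⁺ (outside ∷_) (∈-allSubsets A))

∑-allFin-suc : ∀ n (f : Fin (suc n) → ℕ) → ∑ (allFin (suc n)) f ≡ f zero + (∑[ i ← allFin n ] f (suc i))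
∑-allFin-suc n f = cong (f zero +_) (cong sum
  (trans (List.map-tabulate suc f) (sym (List.map-tabulate (λ i → i) (λ i → f (suc i))))))

pascal : ∀ n k → n C k + n C suc k ≡ suc n C suc k
pascal = nCk+nC[k+1]≡[n+1]C[k+1]

C-step : ∀ n k → n C k ≤ suc n C k
C-step n zero    = ≤-refl
C-step n (suc k) = ≤-trans (m≤n+m (n C suc k) (n C k)) (≤-reflexive (pascal n k))

C-mono : ∀ {m n} k → m ≤ n → m C k ≤ n C k
C-mono k m≤n = go (≤⇒≤′ m≤n)
  where
  go : ∀ {m n} → m ≤′ n → m C k ≤ n C k
  go ≤′-refl        = ≤-refl
  go (≤′-step m≤′n) = ≤-trans (go m≤′n) (C-step _ k)

C-pos : ∀ {n} k → k ≤ n → 1 ≤ n C k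
C-pos zero    _         = ≤-refl
C-pos {suc n} (suc k) (s≤s k≤n) =
  ≤-trans (C-pos k k≤n) (≤-trans (m≤m+n (n C k) _) (≤-reflexive (pascal n k)))

C-strict : ∀ {m n k} → 1 ≤ k → k ≤ n → m < n → m C k < n C k
C-strict {m} {suc n} {suc k} _ (s≤s k≤n) (s≤s m≤n) = begin-strict
  m C suc k               ≤⟨ C-mono (suc k) m≤n ⟩
  n C suc k               <⟨ +-monoˡ-≤ (n C suc k) (C-pos k k≤n) ⟩
  n C k + n C suc k       ≡⟨ pascal n k ⟩
  suc n C suc k           ∎
  where open ≤-Reasoning

C-absorb : ∀ n k → suc k * (suc n C suc k) ≡ suc n * (n C k)
C-absorb n       zero    =
  trans (*-identityˡ (suc n C 1)) (trans (nC1≡n (suc n)) (sym (*-identityʳ (suc n))))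
C-absorb zero    (suc k) = *-zeroʳ (suc (suc k))
C-absorb (suc n) (suc k) = begin
  (2 + k) * (suc (suc n) C suc (suc k))
    ≡⟨ cong ((2 + k) *_) (pascal (suc n) (suc k)) ⟨
  (2 + k) * (m + c₂)
    ≡⟨ regroup k m c₂ ⟩
  m + ((1 + k) * m + (2 + k) * c₂)
    ≡⟨ cong (m +_) (cong₂ _+_ (C-absorb n k) (C-absorb n (suc k))) ⟩
  m + ((1 + n) * c₀ + (1 + n) * c₁)
    ≡⟨ cong (_+ ((1 + n) * c₀ + (1 + n) * c₁)) (pascal n k) ⟨
  (c₀ + c₁) + ((1 + n) * c₀ + (1 + n) * c₁)
    ≡⟨ collect n c₀ c₁ ⟩
  (2 + n) * (c₀ + c₁)
    ≡⟨ cong ((2 + n) *_) (pascal n k) ⟩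
  (2 + n) * m ∎
  where
  open ≡-Reasoning
  c₀ = n C k
  c₁ = n C suc k
  c₂ = suc n C suc (suc k)
  m  = suc n C suc k
  regroup : ∀ k x z → (2 + k) * (x + z) ≡ x + ((1 + k) * x + (2 + k) * z)
  regroup = solve-∀
  collect : ∀ n x y → (x + y) + ((1 + n) * x + (1 + n) * y) ≡ (2 + n) * (x + y)
  collect = solve-∀

ι : Bool → ℕ
ι b = if b then 1 else 0

kSubsetOf : ∀ {n} → ℕ → Subset n → Subset n → Bool
kSubsetOf k S A = does (A ⊆? S) ∧ (∣ A ∣ ≡ᵇ k)

ι-T : ∀ {x} → T x → ι x ≡ 1
ι-T {true} _ = refl

T-kSubsetOf : ∀ {n} {A S : Subset n} {k} → A ⊆ S → ∣ A ∣ ≡ k → T (kSubsetOf k S A)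
T-kSubsetOf {A = A} {S} {k} A⊆S ∣A∣≡k rewrite dec-true (A ⊆? S) A⊆S = ≡⇒≡ᵇ (∣ A ∣) k ∣A∣≡k

T-does : ∀ {P : Set} (d : Dec P) → T (does d) → P
T-does (yes p) _ = p

kSubsetOf-sound : ∀ {n} {A S : Subset n} {k} → T (kSubsetOf k S A) → A ⊆ S × ∣ A ∣ ≡ k
kSubsetOf-sound {A = A} {S} {k} t with Equivalence.to (T-∧ {does (A ⊆? S)}) t
... | t⊆ , t≡ = T-does (A ⊆? S) t⊆ , ≡ᵇ⇒≡ (∣ A ∣) k t≡

through : ∀ {n} → Fin n → Subset n → ℕ → ℕ
through {n} v S k = ∑[ A ← allSubsets n ] ι (does (v ∈? A) ∧ kSubsetOf k S A)

∈⇒∣∣>0 : ∀ {n} {v : Fin n} {A : Subset n} → v ∈ A → 0 < ∣ A ∣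
∈⇒∣∣>0 v∈A = ≤-trans (s≤s z≤n) (x∈p⇒∣p-x∣<∣p∣ v∈A)

count-kSubsets : ∀ {n} (S : Subset n) k → ∑[ A ← allSubsets n ] ι (kSubsetOf k S A) ≡ ∣ S ∣ C k
count-kSubsets []            zero    = refl
count-kSubsets []            (suc k) = refl
count-kSubsets {suc n} (inside ∷ S) zero =
  trans (∑-allSubsets-suc n _)
        (cong₂ _+_ (trans (∑-cong (allSubsets n) (λ A → cong ι (∧-zeroʳ (does (A ⊆? S))))) (∑-zero (allSubsets n)))
                   (count-kSubsets S zero))
count-kSubsets {suc n} (inside ∷ S) (suc k) =
  trans (∑-allSubsets-suc n _)
        (trans (cong₂ _+_ (count-kSubsets S k) (count-kSubsets S (suc k))) (pascal ∣ S ∣ k))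
count-kSubsets {suc n} (outside ∷ S) k =
  trans (∑-allSubsets-suc n _) (cong₂ _+_ (∑-zero (allSubsets n)) (count-kSubsets S k))

through-zero : ∀ {n} (v : Fin n) S → through v S 0 ≡ 0
through-zero {n} v S = trans (∑-cong (allSubsets n) term) (∑-zero (allSubsets n))
  where
  term : ∀ A → ι (does (v ∈? A) ∧ kSubsetOf 0 S A) ≡ 0
  term A with v ∈? A
  ... | no _    = refl
  ... | yes v∈A with ∣ A ∣ | ∈⇒∣∣>0 v∈A
  ...   | suc _ | _ = cong ι (∧-zeroʳ (does (A ⊆? S)))

through-avoid : ∀ {n} {v : Fin n} {S} k → v ∉ S → through v S k ≡ 0
through-avoid {n} {v} {S} k v∉S = trans (∑-cong (allSubsets n) term) (∑-zero (allSubsets n))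
  where
  term : ∀ A → ι (does (v ∈? A) ∧ kSubsetOf k S A) ≡ 0
  term A with v ∈? A | A ⊆? S
  ... | no _    | _        = refl
  ... | yes _   | no _     = refl
  ... | yes v∈A | yes A⊆S = contradiction (A⊆S v∈A) v∉S

count-through : ∀ {n} {v : Fin n} {S} k → v ∈ S → through v S (suc k) ≡ pred ∣ S ∣ C k
count-through {suc n} {zero} {inside ∷ S} k here =
  trans (∑-allSubsets-suc n _) (trans (cong₂ _+_ (count-kSubsets S k) (∑-zero (allSubsets n))) (+-identityʳ _))
count-through {suc n} {suc v} {outside ∷ S} k (there v∈S) =
  trans (∑-allSubsets-suc n _)
        (cong₂ _+_ (trans (∑-cong (allSubsets n) (λ A → cong ι (∧-zeroʳ (does (v ∈? A))))) (∑-zero (allSubsets n)))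
                   (count-through k v∈S))
count-through {suc n} {suc v} {inside ∷ S} zero (there v∈S) =
  trans (∑-allSubsets-suc n _)
        (trans (cong₂ _+_ (through-zero v S) (count-through zero v∈S)) (lemma (∈⇒∣∣>0 v∈S)))
  where
  lemma : ∀ {m} → 0 < m → 0 + pred m C 0 ≡ m C 0
  lemma {suc m} _ = refl
count-through {suc n} {suc v} {inside ∷ S} (suc k) (there v∈S) =
  trans (∑-allSubsets-suc n _)
        (trans (cong₂ _+_ (count-through k v∈S) (count-through (suc k) v∈S)) (lemma (∈⇒∣∣>0 v∈S)))
  where
  lemma : ∀ {m} → 0 < m → pred m C k + pred m C suc k ≡ m C suc k
  lemma {suc m} _ = pascal m k

through≤ : ∀ {n} (v : Fin n) S k → through v S (suc k) ≤ pred ∣ S ∣ C k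
through≤ v S k with v ∈? S
... | yes v∈S = ≤-reflexive (count-through k v∈S)
... | no  v∉S = ≤-trans (≤-reflexive (through-avoid (suc k) v∉S)) z≤n

nonempty : ∀ {n} (A : Subset n) → 0 < ∣ A ∣ → ∃ λ u → u ∈ A
nonempty {n} A ∣A∣>0 with nonempty? A
... | yes A≠∅ = A≠∅
... | no  A=∅ = contradiction (trans (cong ∣_∣ (Empty-unique A=∅)) (∣⊥∣≡0 n)) (>⇒≢ ∣A∣>0)

⊆-∣∣-antisym : ∀ {n} (A S : Subset n) → A ⊆ S → ∣ S ∣ ≤ ∣ A ∣ → A ≡ S
⊆-∣∣-antisym []            []            _   _         = refl
⊆-∣∣-antisym (inside ∷ A)  (inside ∷ S)  A⊆S (s≤s ≤∣A∣) = cong (inside ∷_) (⊆-∣∣-antisym A S (drop-∷-⊆ A⊆S) ≤∣A∣)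
⊆-∣∣-antisym (outside ∷ A) (outside ∷ S) A⊆S ≤∣A∣       = cong (outside ∷_) (⊆-∣∣-antisym A S (drop-∷-⊆ A⊆S) ≤∣A∣)
⊆-∣∣-antisym (outside ∷ A) (inside ∷ S)  A⊆S ≤∣A∣       = contradiction (p⊆q⇒∣p∣≤∣q∣ (drop-∷-⊆ A⊆S)) (<⇒≱ ≤∣A∣)
⊆-∣∣-antisym (inside ∷ A)  (outside ∷ S) A⊆S _          = contradiction (A⊆S here) λ ()

∣∪∣≤ : ∀ {n} (A B : Subset n) → ∣ A ∪ B ∣ ≤ ∣ A ∣ + ∣ B ∣
∣∪∣≤ []            []            = z≤n
∣∪∣≤ (inside ∷ A)  (x ∷ B)       = s≤s (≤-trans (∣∪∣≤ A B) (+-monoʳ-≤ ∣ A ∣ (∣p∣≤∣x∷p∣ x B)))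
∣∪∣≤ (outside ∷ A) (inside ∷ B)  = ≤-trans (s≤s (∣∪∣≤ A B)) (≤-reflexive (sym (+-suc ∣ A ∣ ∣ B ∣)))
∣∪∣≤ (outside ∷ A) (outside ∷ B) = ∣∪∣≤ A B

extend : ∀ {n} (T S : Subset n) k → T ⊆ S → ∣ T ∣ ≤ k → k ≤ ∣ S ∣ →
         ∃ λ X → T ⊆ X × X ⊆ S × ∣ X ∣ ≡ k
extend []            []            zero    _   _         _         = [] , (λ ()) , (λ ()) , refl
extend (inside ∷ T)  (inside ∷ S)  (suc k) T⊆S (s≤s T≤k) (s≤s k≤S) with extend T S k (drop-∷-⊆ T⊆S) T≤k k≤S
... | X , T⊆X , X⊆S , ∣X∣≡k = inside ∷ X , s⊆s T⊆X , s⊆s X⊆S , cong suc ∣X∣≡k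
extend (outside ∷ T) (outside ∷ S) k       T⊆S T≤k       k≤S       with extend T S k (drop-∷-⊆ T⊆S) T≤k k≤S
... | X , T⊆X , X⊆S , ∣X∣≡k = outside ∷ X , s⊆s T⊆X , s⊆s X⊆S , ∣X∣≡k
extend (outside ∷ T) (inside ∷ S)  k       T⊆S T≤k       k≤1+S     with k ≤? ∣ S ∣
... | yes k≤S with extend T S k (drop-∷-⊆ T⊆S) T≤k k≤S
...   | X , T⊆X , X⊆S , ∣X∣≡k = outside ∷ X , s⊆s T⊆X , out⊆ X⊆S , ∣X∣≡k
extend (outside ∷ T) (inside ∷ S)  k       T⊆S T≤k       k≤1+S     | no k≰S =
  inside ∷ S , out⊆ (drop-∷-⊆ T⊆S) , ⊆-refl , ≤-antisym (≰⇒> k≰S) k≤1+S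
extend (inside ∷ T)  (outside ∷ S) k       T⊆S _         _         = contradiction (T⊆S here) λ ()

∣pair∣≤2 : ∀ {n} (u u′ : Fin n) → ∣ ⁅ u ⁆ ∪ ⁅ u′ ⁆ ∣ ≤ 2
∣pair∣≤2 u u′ = ≤-trans (∣∪∣≤ ⁅ u ⁆ ⁅ u′ ⁆) (≤-reflexive (cong₂ _+_ (∣⁅x⁆∣≡1 u) (∣⁅x⁆∣≡1 u′)))

∣∣≡∑ : ∀ {n} (A : Subset n) → ∣ A ∣ ≡ ∑[ v ← allFin n ] ι (does (v ∈? A))
∣∣≡∑ []            = refl
∣∣≡∑ {suc n} (inside ∷ A)  = trans (cong suc (∣∣≡∑ A)) (sym (∑-allFin-suc n (λ v → ι (does (v ∈? inside ∷ A)))))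
∣∣≡∑ {suc n} (outside ∷ A) = trans (∣∣≡∑ A) (sym (∑-allFin-suc n (λ v → ι (does (v ∈? outside ∷ A)))))

∈-tabulate : ∀ {n} (f : Fin n → Bool) {i} → i ∈ tabulate f ⇔ T (f i)
∈-tabulate f {i} = mk⇔
  (λ i∈ → Equivalence.from T-≡ (trans (sym (lookup∘tabulate f i)) ([]=⇒lookup i∈)))
  (λ fi → lookup⇒[]= i _ (trans (lookup∘tabulate f i) (Equivalence.to T-≡ fi)))

∣tabulate∣ : ∀ {n} (f : Fin n → Bool) → ∣ tabulate f ∣ ≡ ∑[ i ← allFin n ] ι (f i)
∣tabulate∣ {zero}  f = refl
∣tabulate∣ {suc n} f = trans (head-count (f zero)) (sym (∑-allFin-suc n (λ i → ι (f i))))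
  where
  head-count : ∀ x → ∣ x ∷ tabulate (λ i → f (suc i)) ∣ ≡ ι x + (∑[ i ← allFin n ] ι (f (suc i)))
  head-count true  = cong suc (∣tabulate∣ (λ i → f (suc i)))
  head-count false = ∣tabulate∣ (λ i → f (suc i))

module _ {n} (G : Graph n) where

  Adj : Fin n → Fin n → Set
  Adj u v = T (adj G u v)

  Adj-sym : ∀ {u v} → Adj u v → Adj v u
  Adj-sym {u} {v} = subst T (Graph.sym G u v)

  Adj-irrefl : ∀ {u} → ¬ Adj u u
  Adj-irrefl {u} = subst (λ b → ¬ T b) (sym (Graph.irrefl G u)) (λ ())

  nbhd : Fin n → Subset n
  nbhd v = tabulate (adj G v)

  ∈-nbhd : ∀ {v u} → u ∈ nbhd v ⇔ Adj v u
  ∈-nbhd {v} = ∈-tabulate (adj G v)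

  ∣nbhd∣≡deg : ∀ v → ∣ nbhd v ∣ ≡ deg G v
  ∣nbhd∣≡deg v = ∣tabulate∣ (adj G v)

  commonNbhd : Subset n → Subset n
  commonNbhd B = tabulate (λ i → isYes (all? (λ j → j ∈? B →-dec T? (adj G i j))))

  ∈-commonNbhd : ∀ {B i} → i ∈ commonNbhd B ⇔ (∀ {j} → j ∈ B → Adj i j)
  ∈-commonNbhd {B} {i} = mk⇔
    (λ i∈ {j} → toWitness (Equivalence.to (∈-tabulate _) i∈) j)
    (λ adjB → Equivalence.from (∈-tabulate _) (fromWitness (λ j → adjB {j})))

  pair⊆nbhd : ∀ {v u u′} → Adj v u → Adj v u′ → ⁅ u ⁆ ∪ ⁅ u′ ⁆ ⊆ nbhd v
  pair⊆nbhd {v} {u} {u′} vu vu′ w∈ with x∈p∪q⁻ ⁅ u ⁆ ⁅ u′ ⁆ w∈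
  ... | inj₁ w∈u  = subst (_∈ nbhd v) (sym (x∈⁅y⁆⇒x≡y u w∈u)) (Equivalence.from ∈-nbhd vu)
  ... | inj₂ w∈u′ = subst (_∈ nbhd v) (sym (x∈⁅y⁆⇒x≡y u′ w∈u′)) (Equivalence.from ∈-nbhd vu′)

  nbhd⇒adj : ∀ {u u′} → nbhd u ≡ nbhd u′ → ∀ w → adj G u w ≡ adj G u′ w
  nbhd⇒adj {u} {u′} eq w =
    trans (sym (lookup∘tabulate (adj G u) w)) (trans (cong (λ S → lookup S w) eq) (lookup∘tabulate (adj G u′) w))

  Complete : Subset n → Subset n → Set
  Complete A B = ∀ {i j} → i ∈ A → j ∈ B → Adj i j

T-allFin : ∀ {n} (p : Fin n → Bool) → T (all p (allFin n)) ⇔ (∀ i → T (p i))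
T-allFin {n} p = mk⇔ (λ t i → All.lookup (all⁺ p (allFin n) t) (∈-allFin i))
                     (λ h → all⁻ p (tabulate⁺ h))

∈⇔T-lookup : ∀ {n} {A : Subset n} {i} → i ∈ A ⇔ T (lookup A i)
∈⇔T-lookup {A = A} {i} = mk⇔ (λ i∈ → Equivalence.from T-≡ ([]=⇒lookup i∈))
                              (λ t → lookup⇒[]= i A (Equivalence.to T-≡ t))

T-→ : ∀ {x y z} → T (not (x ∧ y) ∨ z) ⇔ (T x → T y → T z)
T-→ {true}  {true}  = mk⇔ (λ z _ _ → z) (λ f → f _ _)
T-→ {true}  {false} = mk⇔ (λ _ _ ()) (λ _ → _)
T-→ {false} {_}     = mk⇔ (λ _ ()) (λ _ → _)

T-¬∧ : ∀ {x y} → (T x → T y → ⊥) → T (not (x ∧ y))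
T-¬∧ {true}  {true}  f = f _ _
T-¬∧ {true}  {false} f = _
T-¬∧ {false} {_}     f = _

module _ {n} (a b : ℕ) (G : Graph n) (A B : Subset n) where

  disjointTest : Fin n → Bool
  disjointTest i = not (lookup A i ∧ lookup B i)

  edgeTest : Fin n → Fin n → Bool
  edgeTest i j = not (lookup A i ∧ lookup B j) ∨ adj G i j

  -- (A , B) spans a K_{a,b} iff |A| = a, |B| = b and A is completely joined to B;
  -- disjointness of A and B is automatic in a graph without loops.
  isKab-sound : T (isKab a b G A B) → ∣ A ∣ ≡ a × ∣ B ∣ ≡ b × Complete G A B
  isKab-sound t = ≡ᵇ⇒≡ (∣ A ∣) a tA , ≡ᵇ⇒≡ (∣ B ∣) b tB , complete
    where
    split : ∀ x {y} → T (x ∧ y) → T x × T y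
    split x = Equivalence.to (T-∧ {x})
    tA = proj₁ (split (∣ A ∣ ≡ᵇ a) t)
    tB = proj₁ (split (∣ B ∣ ≡ᵇ b) (proj₂ (split (∣ A ∣ ≡ᵇ a) t)))
    tE = proj₂ (split (all disjointTest (allFin n)) (proj₂ (split (∣ B ∣ ≡ᵇ b) (proj₂ (split (∣ A ∣ ≡ᵇ a) t)))))
    complete : Complete G A B
    complete {i} {j} i∈A j∈B =
      Equivalence.to (T-→ {lookup A i} {lookup B j})
        (Equivalence.to (T-allFin (edgeTest i)) (Equivalence.to (T-allFin (λ i → all (edgeTest i) (allFin n))) tE i) j)
        (Equivalence.to ∈⇔T-lookup i∈A) (Equivalence.to ∈⇔T-lookup j∈B)

  isKab-complete : ∣ A ∣ ≡ a → ∣ B ∣ ≡ b → Complete G A B → T (isKab a b G A B)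
  isKab-complete ∣A∣≡a ∣B∣≡b AB =
    Equivalence.from T-∧ (≡⇒≡ᵇ (∣ A ∣) a ∣A∣≡a ,
    Equivalence.from T-∧ (≡⇒≡ᵇ (∣ B ∣) b ∣B∣≡b ,
    Equivalence.from T-∧ (Equivalence.from (T-allFin disjointTest) disjoint ,
                          Equivalence.from (T-allFin (λ i → all (edgeTest i) (allFin n)))
                            (λ i → Equivalence.from (T-allFin (edgeTest i)) (edge i)))))
    where
    from∈ : ∀ {S : Subset n} {i} → T (lookup S i) → i ∈ S
    from∈ = Equivalence.from ∈⇔T-lookup
    disjoint : ∀ i → T (disjointTest i)
    disjoint i = T-¬∧ λ ti tj → Adj-irrefl G (AB (from∈ ti) (from∈ tj))
    edge : ∀ i j → T (edgeTest i j)
    edge i j = Equivalence.from (T-→ {lookup A i} {lookup B j}) (λ ti tj → AB (from∈ ti) (from∈ tj))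

-- The double-counting bound

orderedKab≡∑ : ∀ {n} a b (G : Graph n) →
  orderedKab a b G ≡ ∑[ A ← allSubsets n ] ∑[ B ← allSubsets n ] ι (isKab a b G A B)
orderedKab≡∑ {n} a b G = sum-concatMap (allSubsets n) (allSubsets n) (λ A B → ι (isKab a b G A B))

module DoubleCounting {n} (G : Graph n) (a′ b′ r′ : ℕ) (Δ≤r : MaxDegAtMost (suc r′) G) where

  a b r : ℕ
  a = suc a′
  b = suc b′
  r = suc r′

  subsets : List (Subset n)
  subsets = allSubsets n

  pairs : ℕ
  pairs = ∑[ A ← subsets ] ∑[ B ← subsets ] ι (isKab a b G A B)

  pairsAt : Fin n → Subset n → ℕ
  pairsAt v B = ∑[ A ← subsets ] ι (does (v ∈? A)) * ι (isKab a b G A B)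

  pairsThrough : Fin n → ℕ
  pairsThrough v = ∑[ B ← subsets ] pairsAt v B

  -- Every pair is counted once for each of the a vertices of its first side.
  handshake : a * pairs ≡ ∑[ v ← allFin n ] pairsThrough v
  handshake = begin
    a * pairs
      ≡⟨ ∑-*ˡ subsets a _ ⟨
    ∑[ A ← subsets ] (a * (∑[ B ← subsets ] kab A B))
      ≡⟨ ∑-cong subsets (λ A → sym (∑-*ˡ subsets a (kab A))) ⟩
    ∑[ A ← subsets ] ∑[ B ← subsets ] (a * kab A B)
      ≡⟨ ∑-cong subsets (λ A → ∑-cong subsets (λ B → weight A B)) ⟩
    ∑[ A ← subsets ] ∑[ B ← subsets ] ∑[ v ← allFin n ] (ι (does (v ∈? A)) * kab A B)
      ≡⟨ ∑-cong subsets (λ A → ∑-swap subsets (allFin n) _) ⟩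
    ∑[ A ← subsets ] ∑[ v ← allFin n ] ∑[ B ← subsets ] (ι (does (v ∈? A)) * kab A B)
      ≡⟨ ∑-swap subsets (allFin n) _ ⟩
    ∑[ v ← allFin n ] ∑[ A ← subsets ] ∑[ B ← subsets ] (ι (does (v ∈? A)) * kab A B)
      ≡⟨ ∑-cong (allFin n) (λ v → ∑-swap subsets subsets _) ⟩
    ∑[ v ← allFin n ] pairsThrough v ∎
    where
    open ≡-Reasoning
    kab : Subset n → Subset n → ℕ
    kab A B = ι (isKab a b G A B)
    size : ∀ A B → a * kab A B ≡ ∣ A ∣ * kab A B
    size A B with isKab a b G A B in eq
    ... | false = trans (*-zeroʳ a) (sym (*-zeroʳ ∣ A ∣))
    ... | true  = cong (_* 1) (sym (proj₁ (isKab-sound a b G A B (subst T (sym eq) _))))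
    weight : ∀ A B → a * kab A B ≡ ∑[ v ← allFin n ] (ι (does (v ∈? A)) * kab A B)
    weight A B = trans (size A B) (trans (cong (_* kab A B) (∣∣≡∑ A)) (sym (∑-*ʳ (allFin n) (kab A B) _)))

  -- If (A , B) spans a K_{a,b} and v ∈ A, then B is a b-subset of N(v) and A is an
  -- a-subset of the common neighbourhood of B containing v.
  pairsAt≤ : ∀ v B → pairsAt v B ≤ ι (kSubsetOf b (nbhd G v) B) * through v (commonNbhd G B) a
  pairsAt≤ v B = ≤-trans (∑-mono subsets term)
    (≤-reflexive (∑-*ˡ subsets (ι (kSubsetOf b (nbhd G v) B)) (λ A → ι (does (v ∈? A) ∧ kSubsetOf a (commonNbhd G B) A))))
    where
    term : ∀ A → ι (does (v ∈? A)) * ι (isKab a b G A B)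
               ≤ ι (kSubsetOf b (nbhd G v) B) * ι (does (v ∈? A) ∧ kSubsetOf a (commonNbhd G B) A)
    term A with v ∈? A | isKab a b G A B in eq
    ... | no  _   | _     = z≤n
    ... | yes _   | false = z≤n
    ... | yes v∈A | true with isKab-sound a b G A B (subst T (sym eq) _)
    ...   | ∣A∣≡a , ∣B∣≡b , AB = ≤-reflexive (sym (cong₂ _*_
              (ι-T (T-kSubsetOf (λ j∈B → Equivalence.from (∈-nbhd G) (AB v∈A j∈B)) ∣B∣≡b))
              (ι-T (T-kSubsetOf (λ i∈A → Equivalence.from (∈-commonNbhd G) (AB i∈A)) ∣A∣≡a))))

  ∣nbhd∣≤r : ∀ u → ∣ nbhd G u ∣ ≤ r
  ∣nbhd∣≤r u = ≤-trans (≤-reflexive (∣nbhd∣≡deg G u)) (Δ≤r u)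

  commonNbhd⊆nbhd : ∀ {B u} → u ∈ B → commonNbhd G B ⊆ nbhd G u
  commonNbhd⊆nbhd u∈B i∈CN =
    Equivalence.from (∈-nbhd G) (Adj-sym G (Equivalence.to (∈-commonNbhd G) i∈CN u∈B))

  ∣commonNbhd∣≤r : ∀ B → 0 < ∣ B ∣ → ∣ commonNbhd G B ∣ ≤ r
  ∣commonNbhd∣≤r B ∣B∣>0 with nonempty B ∣B∣>0
  ... | u , u∈B = ≤-trans (p⊆q⇒∣p∣≤∣q∣ (commonNbhd⊆nbhd u∈B)) (∣nbhd∣≤r u)

  -- κ is the number of a-subsets of an r-set through a fixed point;
  -- μ = C(r,b)·κ is the resulting bound on pairsThrough v.
  κ μ : ℕ
  κ = r′ C a′
  μ = (r C b) * κ

  pairsAt≤κ : ∀ v B → pairsAt v B ≤ ι (kSubsetOf b (nbhd G v) B) * κ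
  pairsAt≤κ v B with kSubsetOf b (nbhd G v) B in eq | pairsAt≤ v B
  ... | false | ≤0 = ≤0
  ... | true  | ≤through = ≤-trans ≤through (+-monoˡ-≤ 0 (≤-trans (through≤ v (commonNbhd G B) a′)
                  (C-mono a′ (pred-mono-≤ (∣commonNbhd∣≤r B ∣B∣>0)))))
    where
    ∣B∣>0 : 0 < ∣ B ∣
    ∣B∣>0 = ≤-trans (s≤s z≤n) (≤-reflexive (sym (proj₂ (kSubsetOf-sound {A = B} {nbhd G v} (subst T (sym eq) _)))))

  -- Summing over B: the b-subsets of N(v) are counted by C(deg v, b).
  pairsThrough≤ : ∀ v → pairsThrough v ≤ (∣ nbhd G v ∣ C b) * κ
  pairsThrough≤ v = ≤-trans (∑-mono subsets (pairsAt≤κ v))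
    (≤-reflexive (trans (∑-*ʳ subsets κ _) (cong (_* κ) (count-kSubsets (nbhd G v) b))))

  pairsThrough≤μ : ∀ v → pairsThrough v ≤ μ
  pairsThrough≤μ v = ≤-trans (pairsThrough≤ v) (*-monoˡ-≤ κ (C-mono b (∣nbhd∣≤r v)))

  handshake≤ : a * pairs ≤ n * μ
  handshake≤ = begin
    a * pairs                          ≡⟨ handshake ⟩
    ∑[ v ← allFin n ] pairsThrough v   ≤⟨ ∑-mono (allFin n) pairsThrough≤μ ⟩
    ∑[ v ← allFin n ] μ                ≡⟨ ∑-allFin-const n μ ⟩
    n * μ                              ∎
    where open ≤-Reasoning

  -- By the absorption identity a·C(r,a) = r·κ, the bound n·μ corresponds to n·C(r,a)·C(r,b).
  P : ℕ
  P = (r C a) * (r C b)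

  rescale : (n * μ) * r ≡ a * (P * n)
  rescale = begin
    (n * μ) * r                 ≡⟨ reorder n (r C b) κ r ⟩
    ((r * κ) * (r C b)) * n     ≡⟨ cong (λ y → (y * (r C b)) * n) (C-absorb r′ a′) ⟨
    ((a * (r C a)) * (r C b)) * n ≡⟨ reassoc a (r C a) (r C b) n ⟩
    a * (P * n)                 ∎
    where
    open ≡-Reasoning
    reorder : ∀ n c k r → (n * (c * k)) * r ≡ ((r * k) * c) * n
    reorder = solve-∀
    reassoc : ∀ a p q n → ((a * p) * q) * n ≡ a * ((p * q) * n)
    reassoc = solve-∀

  bound : pairs * r ≤ P * n
  bound = *-cancelˡ-≤ a (begin
    a * (pairs * r)   ≡⟨ *-assoc a pairs r ⟨
    (a * pairs) * r   ≤⟨ *-monoˡ-≤ r handshake≤ ⟩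
    (n * μ) * r       ≡⟨ rescale ⟩
    a * (P * n)       ∎)
    where open ≤-Reasoning

-- The extremal case: equality forces every local bound to be tight

module Extremal {n} (G : Graph n) (a′ b′ r′ : ℕ) (Δ≤r : MaxDegAtMost (suc r′) G)
                (1≤a′ : 1 ≤ a′) (a′≤r′ : a′ ≤ r′) (1≤b′ : 1 ≤ b′) (b′≤r′ : b′ ≤ r′)
                (tight : DoubleCounting.pairs G a′ b′ r′ Δ≤r * suc r′ ≡ DoubleCounting.P G a′ b′ r′ Δ≤r * n)
                where

  open DoubleCounting G a′ b′ r′ Δ≤r

  handshake-tight : a * pairs ≡ n * μ
  handshake-tight = *-cancelʳ-≡ (a * pairs) (n * μ) r (begin
    (a * pairs) * r   ≡⟨ *-assoc a pairs r ⟩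
    a * (pairs * r)   ≡⟨ cong (a *_) tight ⟩
    a * (P * n)       ≡⟨ rescale ⟨
    (n * μ) * r       ∎)
    where open ≡-Reasoning

  through-tight : ∀ v → pairsThrough v ≡ μ
  through-tight v = ∑-tight (allFin n) pairsThrough≤μ sum≥ (∈-allFin v)
    where
    sum≥ : ∑[ _ ← allFin n ] μ ≤ ∑[ v ← allFin n ] pairsThrough v
    sum≥ = ≤-reflexive (begin
      ∑[ _ ← allFin n ] μ             ≡⟨ ∑-allFin-const n μ ⟩
      n * μ                           ≡⟨ handshake-tight ⟨
      a * pairs                       ≡⟨ handshake ⟩
      ∑[ v ← allFin n ] pairsThrough v ∎)
      where open ≡-Reasoning

  -- κ = C(r-1,a-1) is positive, so it can be cancelled.
  κ>0 : 0 < κ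
  κ>0 = C-pos a′ a′≤r′

  regular : ∀ v → ∣ nbhd G v ∣ ≡ r
  regular v = ≤-antisym (∣nbhd∣≤r v) (≮⇒≥ λ ∣N∣<r → <⇒≱ (C-strict (s≤s z≤n) (s≤s b′≤r′) ∣N∣<r) r≤)
    where
    instance _ = >-nonZero κ>0
    r≤ : r C b ≤ ∣ nbhd G v ∣ C b
    r≤ = *-cancelʳ-≤ (r C b) (∣ nbhd G v ∣ C b) κ
             (≤-trans (≤-reflexive (sym (through-tight v))) (pairsThrough≤ v))

  pairsAt-tight : ∀ v B → pairsAt v B ≡ ι (kSubsetOf b (nbhd G v) B) * κ
  pairsAt-tight v B = ∑-tight subsets (pairsAt≤κ v) sum≥ (∈-allSubsets B)
    where
    sum≥ : ∑[ B ← subsets ] (ι (kSubsetOf b (nbhd G v) B) * κ) ≤ pairsThrough v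
    sum≥ = ≤-reflexive (begin
      ∑[ B ← subsets ] (ι (kSubsetOf b (nbhd G v) B) * κ) ≡⟨ ∑-*ʳ subsets κ _ ⟩
      (∑[ B ← subsets ] ι (kSubsetOf b (nbhd G v) B)) * κ  ≡⟨ cong (_* κ) (count-kSubsets (nbhd G v) b) ⟩
      (∣ nbhd G v ∣ C b) * κ                               ≡⟨ cong (λ d → (d C b) * κ) (regular v) ⟩
      μ                                                    ≡⟨ through-tight v ⟨
      pairsThrough v                                       ∎)
      where open ≡-Reasoning

  commonNbhd-large : ∀ {v B} → B ⊆ nbhd G v → ∣ B ∣ ≡ b → r ≤ ∣ commonNbhd G B ∣
  commonNbhd-large {v} {B} B⊆N ∣B∣≡b = ≮⇒≥ λ ∣CN∣<r →
    <⇒≱ (C-strict 1≤a′ a′≤r′ (pred< ∣CN∣<r)) κ≤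
    where
    selected : ι (kSubsetOf b (nbhd G v) B) ≡ 1
    selected = ι-T (T-kSubsetOf B⊆N ∣B∣≡b)
    κ≤ : κ ≤ pred ∣ commonNbhd G B ∣ C a′
    κ≤ = begin
      κ                                     ≡⟨ trans (cong (_* κ) selected) (*-identityˡ κ) ⟨
      ι (kSubsetOf b (nbhd G v) B) * κ      ≡⟨ pairsAt-tight v B ⟨
      pairsAt v B                           ≤⟨ pairsAt≤ v B ⟩
      ι (kSubsetOf b (nbhd G v) B) * through v (commonNbhd G B) a
                                            ≡⟨ trans (cong (_* through v (commonNbhd G B) a) selected) (*-identityˡ _) ⟩
      through v (commonNbhd G B) a          ≤⟨ through≤ v (commonNbhd G B) a′ ⟩
      pred ∣ commonNbhd G B ∣ C a′           ∎
      where open ≤-Reasoning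
    pred< : ∀ {m} → m < r → pred m < r′
    pred< {zero}  _         = ≤-trans 1≤a′ a′≤r′
    pred< {suc m} (s≤s m<r′) = m<r′

  commonNbhd≡nbhd : ∀ {v B u} → B ⊆ nbhd G v → ∣ B ∣ ≡ b → u ∈ B → commonNbhd G B ≡ nbhd G u
  commonNbhd≡nbhd {B = B} {u} B⊆N ∣B∣≡b u∈B =
    ⊆-∣∣-antisym (commonNbhd G B) (nbhd G u) (commonNbhd⊆nbhd u∈B)
                 (≤-trans (∣nbhd∣≤r u) (commonNbhd-large B⊆N ∣B∣≡b))

  -- Two neighbours of a vertex v have the same neighbourhood: as 2 ≤ b ≤ deg v,
  -- both lie in a common b-subset B of N(v), and both neighbourhoods equal that of B.
  twins : ∀ {v u u′} → Adj G v u → Adj G v u′ → nbhd G u ≡ nbhd G u′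
  twins {v} {u} {u′} vu vu′
    with extend (⁅ u ⁆ ∪ ⁅ u′ ⁆) (nbhd G v) b (pair⊆nbhd G vu vu′)
                (≤-trans (∣pair∣≤2 u u′) (s≤s 1≤b′)) (≤-trans (s≤s b′≤r′) (≤-reflexive (sym (regular v))))
  ... | B , pair⊆B , B⊆N , ∣B∣≡b =
    trans (sym (commonNbhd≡nbhd B⊆N ∣B∣≡b (pair⊆B (p⊆p∪q ⁅ u′ ⁆ (x∈⁅x⁆ u)))))
          (commonNbhd≡nbhd B⊆N ∣B∣≡b (pair⊆B (q⊆p∪q ⁅ u ⁆ ⁅ u′ ⁆ (x∈⁅x⁆ u′))))

-- Recognising K_{r,r}

<ᵇ-irrefl : ∀ k → (k <ᵇ k) ≡ false
<ᵇ-irrefl zero    = refl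
<ᵇ-irrefl (suc k) = <ᵇ-irrefl k

punchIn-<ᵇ : ∀ {n} (p : Fin (suc n)) (y : Fin n) → (toℕ (punchIn p y) <ᵇ toℕ p) ≡ (toℕ y <ᵇ toℕ p)
punchIn-<ᵇ zero    y       = refl
punchIn-<ᵇ (suc p) zero    = refl
punchIn-<ᵇ (suc p) (suc y) = punchIn-<ᵇ p y

sortColouring : ∀ m (c : Fin m → Bool) →
  ∃ λ (π : Permutation m m) → ∀ i → (toℕ (π ⟨$⟩ʳ i) <ᵇ ∣ tabulate c ∣) ≡ c i
sortColouring zero    c = Perm.id , λ ()
sortColouring (suc m) c with sortColouring m (λ i → c (suc i)) | c zero in c₀
... | π , sorted | true  = lift₀ π , λ { zero → sym c₀ ; (suc i) → sorted i }
... | π , sorted | false = insert zero p π , sorted′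
  where
  k = ∣ tabulate (λ i → c (suc i)) ∣
  p : Fin (suc m)
  p = fromℕ< (s≤s (∣p∣≤n (tabulate (λ i → c (suc i)))))
  toℕp : toℕ p ≡ k
  toℕp = toℕ-fromℕ< (s≤s (∣p∣≤n (tabulate (λ i → c (suc i)))))
  sorted′ : ∀ i → (toℕ (insert zero p π ⟨$⟩ʳ i) <ᵇ k) ≡ c i
  sorted′ zero    rewrite toℕp = trans (<ᵇ-irrefl k) (sym c₀)
  sorted′ (suc i) rewrite insert-punchIn zero p π i =
    trans (cong (toℕ (punchIn p (π ⟨$⟩ʳ i)) <ᵇ_) (sym toℕp))
          (trans (punchIn-<ᵇ p (π ⟨$⟩ʳ i)) (trans (cong (toℕ (π ⟨$⟩ʳ i) <ᵇ_) toℕp) (sorted i)))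

bichromatic≅K : ∀ {m} (G : Graph m) r (c : Fin m → Bool) → ∣ tabulate c ∣ ≡ r → m ≡ r + r →
                (∀ i j → adj G i j ≡ (c i xor c j)) → G ≅ K r r
bichromatic≅K G r c ∣c∣≡r refl bichromatic with sortColouring _ c
... | π , sorted = record { bij = π ; preserve = preserve }
  where
  side : ∀ i → (toℕ (π ⟨$⟩ʳ i) <ᵇ r) ≡ c i
  side i = trans (cong (toℕ (π ⟨$⟩ʳ i) <ᵇ_) (sym ∣c∣≡r)) (sorted i)
  preserve : ∀ i j → adj G i j ≡ adj (K r r) (π ⟨$⟩ʳ i) (π ⟨$⟩ʳ j)
  preserve i j = trans (bichromatic i j) (sym (cong₂ _xor_ (side i) (side j)))

-- A connected graph with at least one vertex, all of whose neighbourhoods have r ≥ 1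
-- elements, and in which any two neighbours of a vertex have equal neighbourhoods,
-- is K_{r,r}: fixing an edge v₀u₀, every vertex is adjacent to exactly one of u₀, v₀,
-- and the two resulting sides are joined completely.
module TwinGraph {n} (G : Graph (suc n)) (r : ℕ) (r>0 : 0 < r)
                 (regular : ∀ v → ∣ nbhd G v ∣ ≡ r)
                 (twins : ∀ {v u u′} → Adj G v u → Adj G v u′ → nbhd G u ≡ nbhd G u′)
                 (connected : Connected G) where

  v₀ : Fin (suc n)
  v₀ = zero

  -- An edge v₀u₀ to start from: N(v₀) has r ≥ 1 elements.
  neighbour : ∃ λ u → u ∈ nbhd G v₀
  neighbour = nonempty (nbhd G v₀) (subst (0 <_) (sym (regular v₀)) r>0)

  u₀ : Fin (suc n)
  u₀ = proj₁ neighbour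

  v₀u₀ : Adj G v₀ u₀
  v₀u₀ = Equivalence.to (∈-nbhd G) (proj₂ neighbour)

  like-v₀ : ∀ {w} → Adj G u₀ w → ∀ z → adj G w z ≡ adj G v₀ z
  like-v₀ u₀w = nbhd⇒adj G (twins u₀w (Adj-sym G v₀u₀))

  like-u₀ : ∀ {w} → Adj G v₀ w → ∀ z → adj G w z ≡ adj G u₀ z
  like-u₀ v₀w = nbhd⇒adj G (twins v₀w v₀u₀)

  Side : Fin (suc n) → Set
  Side w = Adj G u₀ w ⊎ Adj G v₀ w

  -- Walks alternate between the sides, so by connectivity every vertex has a side ...
  walk : ∀ {x w} → Reachable G x w → Side x → Side w
  walk here                   side       = side
  walk (step {v = v} uv rest) (inj₁ u₀u) = walk rest (inj₂ (subst T (like-v₀ u₀u v) uv))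
  walk (step {v = v} uv rest) (inj₂ v₀u) = walk rest (inj₁ (subst T (like-u₀ v₀u v) uv))

  covers : ∀ w → Side w
  covers w = walk (connected v₀ w) (inj₁ (Adj-sym G v₀u₀))

  -- ... and only one, since a vertex of both sides would be adjacent to itself.
  exclusive : ∀ {w} → Adj G u₀ w → ¬ Adj G v₀ w
  exclusive {w} u₀w v₀w = Adj-irrefl G (subst T (sym (like-v₀ u₀w w)) v₀w)

  colour : Fin (suc n) → Bool
  colour = adj G u₀

  complementary : ∀ w → adj G v₀ w ≡ not (colour w)
  complementary w with adj G u₀ w in p | adj G v₀ w in q
  ... | true  | true  = contradiction (subst T (sym q) _) (exclusive (subst T (sym p) _))
  ... | true  | false = refl
  ... | false | true  = refl
  ... | false | false with covers w
  ...   | inj₁ u₀w = contradiction (subst T p u₀w) λ ()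
  ...   | inj₂ v₀w = contradiction (subst T q v₀w) λ ()

  bichromatic : ∀ i j → adj G i j ≡ (colour i xor colour j)
  bichromatic i j with colour i in p
  ... | true  = trans (like-v₀ (subst T (sym p) _) j) (complementary j)
  ... | false with covers i
  ...   | inj₁ u₀i = contradiction (subst T p u₀i) λ ()
  ...   | inj₂ v₀i = like-u₀ v₀i j

  size : suc n ≡ r + r
  size = begin
    suc n                                   ≡⟨ m+[n∸m]≡n (∣p∣≤n (nbhd G u₀)) ⟨
    ∣ nbhd G u₀ ∣ + (suc n ∸ ∣ nbhd G u₀ ∣)  ≡⟨ cong (∣ nbhd G u₀ ∣ +_) (∣∁p∣≡n∸∣p∣ (nbhd G u₀)) ⟨
    ∣ nbhd G u₀ ∣ + ∣ ∁ (nbhd G u₀) ∣        ≡⟨ cong (λ S → ∣ nbhd G u₀ ∣ + ∣ S ∣) ∁N≡N ⟩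
    ∣ nbhd G u₀ ∣ + ∣ nbhd G v₀ ∣            ≡⟨ cong₂ _+_ (regular u₀) (regular v₀) ⟩
    r + r                                   ∎
    where
    open ≡-Reasoning
    ∁N≡N : ∁ (nbhd G u₀) ≡ nbhd G v₀
    ∁N≡N = trans (sym (tabulate-∘ not colour)) (tabulate-cong (λ w → sym (complementary w)))

  iso : G ≅ K r r
  iso = bichromatic≅K G r colour (regular u₀) size bichromatic

left right : ∀ r s → Subset (r + s)
left  r s = tabulate (λ w → toℕ w <ᵇ r)
right r s = tabulate (λ w → not (toℕ w <ᵇ r))

∣left∣ : ∀ r s → ∣ left r s ∣ ≡ r
∣left∣ zero    s = none s
  where
  none : ∀ s → ∣ tabulate {s} (λ _ → false) ∣ ≡ 0
  none zero    = refl
  none (suc s) = none s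
∣left∣ (suc r) s = cong suc (∣left∣ r s)

∣right∣ : ∀ r s → ∣ right r s ∣ ≡ s
∣right∣ zero    s = every s
  where
  every : ∀ s → ∣ tabulate {s} (λ _ → true) ∣ ≡ s
  every zero    = refl
  every (suc s) = cong suc (every s)
∣right∣ (suc r) s = ∣right∣ r s

nbhd-K : ∀ r s v → nbhd (K r s) v ≡ (if toℕ v <ᵇ r then right r s else left r s)
nbhd-K r s v with toℕ v <ᵇ r
... | true  = refl
... | false = refl

K-maxDeg : ∀ r → MaxDegAtMost r (K r r)
K-maxDeg r v = ≤-reflexive (trans (sym (∣nbhd∣≡deg (K r r) v)) (trans (cong ∣_∣ (nbhd-K r r v)) (side (toℕ v <ᵇ r))))
  where
  side : ∀ x → ∣ (if x then right r r else left r r) ∣ ≡ r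
  side true  = ∣right∣ r r
  side false = ∣left∣ r r

left-right-complete : ∀ r s → Complete (K r s) (left r s) (right r s)
left-right-complete r s {i} {j} i∈L j∈R =
  bichromatic (Equivalence.to (∈-tabulate _) i∈L) (Equivalence.to (∈-tabulate _) j∈R)
  where
  bichromatic : ∀ {x y} → T x → T (not y) → T (x xor y)
  bichromatic {true} {false} _ _ = _

left-right-disjoint : ∀ r s {i} → i ∈ left r s → ¬ i ∈ right r s
left-right-disjoint r s {i} i∈L i∈R =
  opposite (Equivalence.to (∈-tabulate _) i∈L) (Equivalence.to (∈-tabulate _) i∈R)
  where
  opposite : ∀ {x} → T x → ¬ T (not x)
  opposite {true} _ ()

ι-cases : ∀ {x y x′ y′ z} → (T x → T y → T z) → (T x′ → T y′ → T z) → (T x → T x′ → ⊥) →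
          ι x * ι y + ι x′ * ι y′ ≤ ι z
ι-cases {true}  {true}  {true}            f g h = ⊥-elim (h _ _)
ι-cases {true}  {true}  {false}           f g h = ≤-reflexive (sym (ι-T (f _ _)))
ι-cases {true}  {false} {true}            f g h = ⊥-elim (h _ _)
ι-cases {true}  {false} {false}           f g h = z≤n
ι-cases {false} {_}     {true}  {true}    f g h = ≤-reflexive (sym (ι-T (g _ _)))
ι-cases {false} {_}     {true}  {false}   f g h = z≤n
ι-cases {false} {_}     {false}           f g h = z≤n

-- K_{r,s} contains C(r,a)·C(s,b) + C(s,a)·C(r,b) ordered copies of K_{a,b}:
-- choose A inside one side and B inside the other.
K-lower : ∀ a b r s → 0 < a → (r C a) * (s C b) + (s C a) * (r C b) ≤ orderedKab a b (K r s)
K-lower a b r s a>0 = begin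
  (r C a) * (s C b) + (s C a) * (r C b)
    ≡⟨ cong₂ _+_ (cong₂ _*_ (countL a) (countR b)) (cong₂ _*_ (countR a) (countL b)) ⟨
  ∑ S (sub L a) * ∑ S (sub R b) + ∑ S (sub R a) * ∑ S (sub L b)
    ≡⟨ cong₂ _+_ (∑-product S S (sub L a) (sub R b)) (∑-product S S (sub R a) (sub L b)) ⟨
  (∑[ A ← S ] ∑[ B ← S ] (sub L a A * sub R b B)) + (∑[ A ← S ] ∑[ B ← S ] (sub R a A * sub L b B))
    ≡⟨ ∑-+ S _ _ ⟨
  ∑[ A ← S ] ((∑[ B ← S ] (sub L a A * sub R b B)) + (∑[ B ← S ] (sub R a A * sub L b B)))
    ≡⟨ ∑-cong S (λ A → ∑-+ S _ _) ⟨
  ∑[ A ← S ] ∑[ B ← S ] (sub L a A * sub R b B + sub R a A * sub L b B)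
    ≤⟨ ∑-mono S (λ A → ∑-mono S (λ B → ι-cases (spans {A} {B} L R (left-right-complete r s))
                                               (spans {A} {B} R L (λ i∈R j∈L → Adj-sym (K r s) (left-right-complete r s j∈L i∈R)))
                                               (one-side A))) ⟩
  ∑[ A ← S ] ∑[ B ← S ] ι (isKab a b (K r s) A B)
    ≡⟨ orderedKab≡∑ a b (K r s) ⟨
  orderedKab a b (K r s) ∎
  where
  open ≤-Reasoning
  S = allSubsets (r + s)
  L = left r s
  R = right r s
  sub : Subset (r + s) → ℕ → Subset (r + s) → ℕ
  sub X k A = ι (kSubsetOf k X A)
  countL : ∀ k → ∑ S (sub L k) ≡ r C k
  countL k = trans (count-kSubsets L k) (cong (_C k) (∣left∣ r s))
  countR : ∀ k → ∑ S (sub R k) ≡ s C k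
  countR k = trans (count-kSubsets R k) (cong (_C k) (∣right∣ r s))
  spans : ∀ {A B} X Y → Complete (K r s) X Y → T (kSubsetOf a X A) → T (kSubsetOf b Y B) → T (isKab a b (K r s) A B)
  spans {A} {B} X Y XY tA tB with kSubsetOf-sound {A = A} {X} tA | kSubsetOf-sound {A = B} {Y} tB
  ... | A⊆X , ∣A∣≡a | B⊆Y , ∣B∣≡b = isKab-complete a b (K r s) A B ∣A∣≡a ∣B∣≡b (λ i∈A j∈B → XY (A⊆X i∈A) (B⊆Y j∈B))
  one-side : ∀ A → T (kSubsetOf a L A) → T (kSubsetOf a R A) → ⊥
  one-side A tL tR with kSubsetOf-sound {A = A} {L} tL | kSubsetOf-sound {A = A} {R} tR
  ... | A⊆L , ∣A∣≡a | A⊆R , _ with nonempty A (subst (0 <_) (sym ∣A∣≡a) a>0)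
  ...   | i , i∈A = left-right-disjoint r s (A⊆L i∈A) (A⊆R i∈A)

-- From ordered pairs to copies of K_{a,b}

double : ∀ y r → y * (r + r) ≡ (y * 2) * r
double = solve-∀

half : ∀ p → (p + p) / 2 ≡ p
half p = trans (cong (_/ 2) (+-*-two p)) (m*n/n≡m p 2)
  where
  +-*-two : ∀ p → p + p ≡ p * 2
  +-*-two = solve-∀

unordered-≤ : ∀ (β : Bool) x p n r → x * r ≤ p * n →
  (if β then x / 2 else x) * (r + r) ≤ (if β then (p + p) / 2 else p + p) * n
unordered-≤ false x p n r x≤ = begin
  x * (r + r)           ≡⟨ *-distribˡ-+ x r r ⟩
  x * r + x * r         ≤⟨ +-mono-≤ x≤ x≤ ⟩
  p * n + p * n         ≡⟨ *-distribʳ-+ n p p ⟨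
  (p + p) * n           ∎
  where open ≤-Reasoning
unordered-≤ true  x p n r x≤ = begin
  x / 2 * (r + r)       ≡⟨ double (x / 2) r ⟩
  (x / 2 * 2) * r       ≤⟨ *-monoˡ-≤ r (m/n*n≤m x 2) ⟩
  x * r                 ≤⟨ x≤ ⟩
  p * n                 ≡⟨ cong (_* n) (half p) ⟨
  (p + p) / 2 * n       ∎
  where open ≤-Reasoning

unordered-≡ : ∀ (β : Bool) x p n r → x * r ≤ p * n →
  (if β then x / 2 else x) * (r + r) ≡ (if β then (p + p) / 2 else p + p) * n → x * r ≡ p * n
unordered-≡ false x p n r _ e = *-cancelˡ-≡ (x * r) (p * n) 2 (begin
  2 * (x * r)           ≡⟨ double′ x r ⟩
  x * (r + r)           ≡⟨ e ⟩
  (p + p) * n           ≡⟨ double″ p n ⟩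
  2 * (p * n)           ∎)
  where
  open ≡-Reasoning
  double′ : ∀ x r → 2 * (x * r) ≡ x * (r + r)
  double′ = solve-∀
  double″ : ∀ p n → (p + p) * n ≡ 2 * (p * n)
  double″ = solve-∀
unordered-≡ true  x p n r x≤ e = ≤-antisym x≤ (begin
  p * n                 ≡⟨ cong (_* n) (half p) ⟨
  (p + p) / 2 * n       ≡⟨ e ⟨
  x / 2 * (r + r)       ≡⟨ double (x / 2) r ⟩
  (x / 2 * 2) * r       ≤⟨ *-monoˡ-≤ r (m/n*n≤m x 2) ⟩
  x * r                 ∎)
  where open ≤-Reasoning

module _ (a′ b′ r′ : ℕ) where

  private
    a b r P : ℕ
    a = suc a′
    b = suc b′
    r = suc r′
    P = (r C a) * (r C b)

  ordered-bound : ∀ {n} (G : Graph n) → MaxDegAtMost r G → orderedKab a b G * r ≤ P * n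
  ordered-bound G Δ≤r =
    subst (λ x → x * r ≤ P * _) (sym (orderedKab≡∑ a b G)) (DoubleCounting.bound G a′ b′ r′ Δ≤r)

  ordered-K : orderedKab a b (K r r) ≡ P + P
  ordered-K = ≤-antisym (*-cancelʳ-≤ (orderedKab a b (K r r)) (P + P) r upper) (K-lower a b r r (s≤s z≤n))
    where
    upper : orderedKab a b (K r r) * r ≤ (P + P) * r
    upper = ≤-trans (ordered-bound (K r r) (K-maxDeg r)) (≤-reflexive (swap P r))
      where
      swap : ∀ p r → p * (r + r) ≡ (p + p) * r
      swap = solve-∀

  N-bound : ∀ {n} (G : Graph n) → MaxDegAtMost r G → N a b G * (r + r) ≤ N a b (K r r) * n
  N-bound {n} G Δ≤r = subst (λ k → N a b G * (r + r) ≤ (if a ≡ᵇ b then k / 2 else k) * n) (sym ordered-K)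
    (unordered-≤ (a ≡ᵇ b) (orderedKab a b G) P n r (ordered-bound G Δ≤r))

  N-tight : ∀ {n} (G : Graph n) (Δ≤r : MaxDegAtMost r G) → N a b G * (r + r) ≡ N a b (K r r) * n →
            DoubleCounting.pairs G a′ b′ r′ Δ≤r * r ≡ P * n
  N-tight {n} G Δ≤r attains = subst (λ x → x * r ≡ P * n) (orderedKab≡∑ a b G)
    (unordered-≡ (a ≡ᵇ b) (orderedKab a b G) P n r (ordered-bound G Δ≤r)
      (subst (λ k → N a b G * (r + r) ≡ (if a ≡ᵇ b then k / 2 else k) * n) ordered-K attains))

proposition4 : (a b r : ℕ) → 2 ≤ a → 2 ≤ b → a ≤ r → b ≤ r →
    MaxDegAtMost r (K r r)
    × (∀ (n : ℕ) (G : Graph n) → 1 ≤ n → MaxDegAtMost r G →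
         N a b G * (r + r) ≤ N a b (K r r) * n)
    × (∀ (n : ℕ) (G : Graph n) → 1 ≤ n → MaxDegAtMost r G → Connected G →
         N a b G * (r + r) ≡ N a b (K r r) * n → G ≅ K r r)
proposition4 (suc a′) (suc b′) (suc r′) (s≤s 1≤a′) (s≤s 1≤b′) (s≤s a′≤r′) (s≤s b′≤r′) =
  K-maxDeg (suc r′) , (λ n G _ → N-bound a′ b′ r′ G) , uniqueness
  where
  uniqueness : ∀ n (G : Graph n) → 1 ≤ n → MaxDegAtMost (suc r′) G → Connected G →
               N (suc a′) (suc b′) G * (suc r′ + suc r′) ≡ N (suc a′) (suc b′) (K (suc r′) (suc r′)) * n →
               G ≅ K (suc r′) (suc r′)
  uniqueness (suc n) G _ Δ≤r connected attains =
    TwinGraph.iso G (suc r′) (s≤s z≤n) regular twins connected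
    where open Extremal G a′ b′ r′ Δ≤r 1≤a′ a′≤r′ 1≤b′ b′≤r′ (N-tight a′ b′ r′ G Δ≤r attains)
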